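{- In Picaria, player X cannot win when moving from a Loop position; that is, from a Loop position with X to move, O has a strategy guaranteeing that X never obtains three X-stones on a line.
   Context: Picaria is played on the nine nodes of a $3\times 3$ grid; write $(r,c)$ for the node in row $r$ (rows $1,2,3$ from top to bottom) and column $c$ (columns $1,2,3$ from left to right). Two nodes are adjacent if they are distinct neighbours horizontally, vertically or diagonally. A line is one of the eight triples of nodes forming a row, a column or a main diagonal. Players X and O each own three stones and alternate turns; after all six stones are placed, in the sliding phase the mover slides one of its own stones to an adjacent empty node. A player wins as soon as its three stones occupy a line; infinite play is a draw. A Loop position is the sliding-phase position with O-stones on $(1,3),(2,1),(3,3)$, X-stones on $(2,2),(2,3),(3,1)$ (all other nodes empty) and X to move, or any image of it under a rotation or reflection of the board. -}

module Defs where

open import Data.Fin using (Fin; zero; suc; toℕ)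
open import Data.Nat using (ℕ; _≤_; _∸_; _+_)
open import Data.Bool using (Bool; true; false; if_then_else_)
open import Data.Product using (Σ; _×_; _,_; ∃)
open import Data.List using (List; []; _∷_)
open import Data.List.Relation.Unary.Any using (Any)
open import Relation.Binary.PropositionalEquality using (_≡_; _≢_)
open import Relation.Nullary using (¬_)

-- Nodes (r , c): row r, column c, each in {0,1,2} (paper's 1,2,3 shifted down by one).
Node : Set
Node = Fin 3 × Fin 3

data Cell : Set where
  empty xs os : Cell

Board : Set
Board = Node → Cell

dist : ℕ → ℕ → ℕ
dist a b = (a ∸ b) + (b ∸ a)

Adjacent : Node → Node → Set
Adjacent (r , c) (r' , c') =
  (r , c) ≢ (r' , c') × dist (toℕ r) (toℕ r') ≤ 1 × dist (toℕ c) (toℕ c') ≤ 1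

n : ℕ → ℕ → Node
n 0 0 = zero , zero
n 0 1 = zero , suc zero
n 0 _ = zero , suc (suc zero)
n 1 0 = suc zero , zero
n 1 1 = suc zero , suc zero
n 1 _ = suc zero , suc (suc zero)
n _ 0 = suc (suc zero) , zero
n _ 1 = suc (suc zero) , suc zero
n _ _ = suc (suc zero) , suc (suc zero)

Line : Set
Line = Node × Node × Node

lines : List Line
lines =
  (n 0 0 , n 0 1 , n 0 2) ∷ (n 1 0 , n 1 1 , n 1 2) ∷ (n 2 0 , n 2 1 , n 2 2) ∷
  (n 0 0 , n 1 0 , n 2 0) ∷ (n 0 1 , n 1 1 , n 2 1) ∷ (n 0 2 , n 1 2 , n 2 2) ∷
  (n 0 0 , n 1 1 , n 2 2) ∷ (n 0 2 , n 1 1 , n 2 0) ∷ []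

Wins : Cell → Board → Set
Wins s b = Any (λ { (p , q , r) → b p ≡ s × b q ≡ s × b r ≡ s }) lines

Slide : Cell → Board → Board → Set
Slide s b b' = Σ Node λ p → Σ Node λ q →
  Adjacent p q × b p ≡ s × b q ≡ empty × b' p ≡ empty × b' q ≡ s ×
  ((u : Node) → u ≢ p → u ≢ q → b' u ≡ b u)

flip3 : Fin 3 → Fin 3
flip3 zero = suc (suc zero)
flip3 (suc zero) = suc zero
flip3 (suc (suc zero)) = zero

swapIf : Bool → Node → Node
swapIf true (r , c) = c , r
swapIf false (r , c) = r , c

flipIf : Bool → Fin 3 → Fin 3
flipIf true = flip3
flipIf false = λ i → i

-- symmetry determined by (transpose?, flip rows?, flip columns?); these are exactly
-- the 8 rotations / reflections of the square grid
sym : Bool → Bool → Bool → Node → Node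
sym t fr fc p with swapIf t p
... | (r , c) = flipIf fr r , flipIf fc c

loop₀ : Board
loop₀ (zero , suc (suc zero)) = os
loop₀ (suc zero , zero) = os
loop₀ (suc (suc zero) , suc (suc zero)) = os
loop₀ (suc zero , suc zero) = xs
loop₀ (suc zero , suc (suc zero)) = xs
loop₀ (suc (suc zero) , zero) = xs
loop₀ _ = empty

-- b is a Loop board (X to move is implicit: it is used as a position with X to move)
IsLoop : Board → Set
IsLoop b = Σ Bool λ t → Σ Bool λ fr → Σ Bool λ fc → (p : Node) → b p ≡ loop₀ (sym t fr fc p)

-- A strategy for O: given the history of the play (most recent board first, the head
-- being the current board with O to move), the board O moves to.
OStrategy : Set
OStrategy = List Board → Board

mutual
  data ReachX (σ : OStrategy) (b₀ : Board) : List Board → Set where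
    start : ReachX σ b₀ (b₀ ∷ [])
    ostep : ∀ {b h} → ReachO σ b₀ (b ∷ h) → ¬ Wins xs b → ¬ Wins os b →
            ReachX σ b₀ (σ (b ∷ h) ∷ b ∷ h)

  data ReachO (σ : OStrategy) (b₀ : Board) : List Board → Set where
    xstep : ∀ {b b' h} → ReachX σ b₀ (b ∷ h) → ¬ Wins xs b → ¬ Wins os b →
            Slide xs b b' → ReachO σ b₀ (b' ∷ b ∷ h)

OPreventsXWin : OStrategy → Board → Set
OPreventsXWin σ b₀ =
  (∀ {b h} → ReachO σ b₀ (b ∷ h) → ¬ Wins xs b → ¬ Wins os b → Slide os b (σ (b ∷ h))) ×
  (∀ {b h} → ReachX σ b₀ (b ∷ h) → ¬ Wins xs b) ×
  (∀ {b h} → ReachO σ b₀ (b ∷ h) → ¬ Wins xs b)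

-- O keeps the play inside a set of X-to-move boards that is closed under one round of
-- play: on each of them X has no line, and each X slide that does not complete an X line
-- can be answered by an O slide back into the set (unless O has already won).  Such a
-- set is the greatest fixed point of this one-round operator; iterating it from the
-- boards with three stones of each colour stabilises after three steps (at 652 boards),
-- and closedness together with membership of the eight Loop boards is then checked by
-- evaluation.  Soundness rests only on the final set passing this check, not on how it
-- was computed.
module Submission where

open import Defs
open import Data.Bool.Base using (Bool; true; false; T; _∧_)
open import Data.Empty using (⊥-elim)
open import Data.Fin.Base using (Fin; toℕ; combine; remQuot)
open import Data.Fin.Properties using (remQuot-combine; combine-remQuot) renaming (_≟_ to _≟ᶠ_)
open import Data.List.Base using (List; []; _∷_; map; filter; cartesianProduct; allFin)
open import Data.List.Membership.Propositional using (_∈_; find)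
open import Data.List.Membership.Propositional.Properties
  using (∈-map⁺; ∈-map⁻; ∈-filter⁺; ∈-filter⁻; ∈-cartesianProduct⁺; ∈-cartesianProduct⁻; ∈-allFin)
open import Data.List.Relation.Unary.Any as Any using (here; there; any?)
open import Data.List.Relation.Unary.All as All using (all?)
open import Data.Nat.Base using (ℕ; zero; suc; _≡ᵇ_)
open import Data.Nat.Properties using (_≤?_)
open import Data.Product.Base using (Σ; ∃; _×_; _,_; proj₁; proj₂; uncurry)
open import Data.Product.Properties using (≡-dec)
open import Data.Sum.Base using (_⊎_; inj₁; inj₂)
open import Data.Vec.Base as Vec using (Vec; []; _∷_; tabulate; _[_]≔_)
open import Data.Vec.Properties using (lookup∘tabulate; tabulate∘lookup; tabulate-cong; lookup∘update; lookup∘update′)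
open import Function.Base using (_∘_)
open import Level using (0ℓ)
open import Relation.Binary.Definitions using (DecidableEquality)
open import Relation.Binary.PropositionalEquality
  using (_≡_; _≢_; refl; trans; cong; subst; _≗_) renaming (sym to ≡-sym)
open import Relation.Nullary using (¬_; Dec; yes; no; does; ¬?; _×-dec_; _⊎-dec_; _→-dec_)
open import Relation.Nullary.Decidable using (map′; T?)
open import Relation.Unary using (Pred; Decidable)

_≟ᶜ_ : DecidableEquality Cell
empty ≟ᶜ empty = yes refl
empty ≟ᶜ xs    = no λ ()
empty ≟ᶜ os    = no λ ()
xs    ≟ᶜ empty = no λ ()
xs    ≟ᶜ xs    = yes refl
xs    ≟ᶜ os    = no λ ()
os    ≟ᶜ empty = no λ ()
os    ≟ᶜ xs    = no λ ()
os    ≟ᶜ os    = yes refl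

_≟ⁿ_ : DecidableEquality Node
_≟ⁿ_ = ≡-dec _≟ᶠ_ _≟ᶠ_

from-does : {A : Set} (a? : Dec A) → does a? ≡ true → A
from-does (yes a) _  = a
from-does (no _)  ()

∀-complete? : {A : Set} {P : Pred A 0ℓ} (as : List A) → (∀ a → a ∈ as) →
              Decidable P → Dec (∀ a → P a)
∀-complete? as complete P? =
  map′ (λ all a → All.lookup all (complete a)) (λ all → All.tabulate (λ {a} _ → all a)) (all? P? as)

∀-Bool? : {P : Pred Bool 0ℓ} → Decidable P → Dec (∀ a → P a)
∀-Bool? = ∀-complete? (true ∷ false ∷ []) λ { true → here refl ; false → there (here refl) }

∀-Cell? : {P : Pred Cell 0ℓ} → Decidable P → Dec (∀ a → P a)
∀-Cell? = ∀-complete? (empty ∷ xs ∷ os ∷ [])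
  λ { empty → here refl ; xs → there (here refl) ; os → there (there (here refl)) }

∀-Vec? : ∀ {k} {P : Pred (Vec Cell k) 0ℓ} → Decidable P → Dec (∀ c → P c)
∀-Vec? {zero}  P? = map′ (λ { p [] → p }) (λ p → p []) (P? [])
∀-Vec? {suc k} P? =
  map′ (λ { p (a ∷ c) → p a c }) (λ p a c → p (a ∷ c)) (∀-Cell? λ a → ∀-Vec? λ c → P? (a ∷ c))

adjacent? : ∀ p q → Dec (Adjacent p q)
adjacent? (r , c) (r' , c') =
  ¬? ((r , c) ≟ⁿ (r' , c')) ×-dec dist (toℕ r) (toℕ r') ≤? 1 ×-dec dist (toℕ c) (toℕ c') ≤? 1

wins? : ∀ s b → Dec (Wins s b)
wins? s b = any? (λ { (p , q , r) → b p ≟ᶜ s ×-dec b q ≟ᶜ s ×-dec b r ≟ᶜ s }) lines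

Wins-resp-≗ : ∀ {s b b'} → b ≗ b' → Wins s b → Wins s b'
Wins-resp-≗ b≗b' = Any.map λ { (bp , bq , br) →
  trans (≡-sym (b≗b' _)) bp , trans (≡-sym (b≗b' _)) bq , trans (≡-sym (b≗b' _)) br }

Slide-resp-≗ : ∀ {s b₁ b₂ b₁' b₂'} → b₁ ≗ b₂ → b₁' ≗ b₂' → Slide s b₁ b₁' → Slide s b₂ b₂'
Slide-resp-≗ e e' (p , q , adj , bp , bq , b'p , b'q , rest) =
  p , q , adj , trans (≡-sym (e p)) bp , trans (≡-sym (e q)) bq ,
  trans (≡-sym (e' p)) b'p , trans (≡-sym (e' q)) b'q ,
  λ u u≢p u≢q → trans (≡-sym (e' u)) (trans (rest u u≢p u≢q) (e u))

Answerable : Pred Board 0ℓ → Pred Board 0ℓ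
Answerable S b = ¬ Wins xs b × ∃ λ b' → Slide os b b' × S b'

Answerable-resp-≗ : ∀ {S b₁ b₂} → b₁ ≗ b₂ → Answerable S b₁ → Answerable S b₂
Answerable-resp-≗ e (¬won , b' , sl , sb') =
  ¬won ∘ Wins-resp-≗ (≡-sym ∘ e) , b' , Slide-resp-≗ e (λ _ → refl) sl , sb'

Defensible : Pred Board 0ℓ → Pred Board 0ℓ
Defensible S b = ¬ Wins xs b × (Wins os b ⊎ (∀ b' → Slide xs b b' → Answerable S b'))

Defensible-resp-≗ : ∀ {S b₁ b₂} → b₁ ≗ b₂ → Defensible S b₁ → Defensible S b₂
Defensible-resp-≗ e (¬won , inj₁ lost)    = ¬won ∘ Wins-resp-≗ (≡-sym ∘ e) , inj₁ (Wins-resp-≗ e lost)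
Defensible-resp-≗ e (¬won , inj₂ answers) =
  ¬won ∘ Wins-resp-≗ (≡-sym ∘ e) , inj₂ λ b' sl → answers b' (Slide-resp-≗ (≡-sym ∘ e) (λ _ → refl) sl)

module InvariantStrategy {S : Pred Board 0ℓ} (reply? : ∀ b → Dec (∃ λ b' → Slide os b b' × S b')) where

  respond : Board → Board
  respond b with reply? b
  ... | yes (b' , _) = b'
  ... | no _         = b

  respond-correct : ∀ {b} → (∃ λ b' → Slide os b b' × S b') → Slide os b (respond b) × S (respond b)
  respond-correct {b} reply with reply? b
  ... | yes (_ , sl , sb') = sl , sb'
  ... | no ¬reply          = ⊥-elim (¬reply reply)

  strategy : OStrategy
  strategy []      = loop₀  -- never consulted: a history always contains its current board
  strategy (b ∷ _) = respond b

  module _ (invariant : ∀ {b} → S b → Defensible S b) {b₀ : Board} (S-b₀ : S b₀) where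

    mutual
      reachX-S : ∀ {b h} → ReachX strategy b₀ (b ∷ h) → S b
      reachX-S start         = S-b₀
      reachX-S (ostep r _ _) = proj₂ (respond-correct (proj₂ (reachO-answerable r)))

      reachO-answerable : ∀ {b h} → ReachO strategy b₀ (b ∷ h) → Answerable S b
      reachO-answerable (xstep r _ ¬lost sl) with invariant (reachX-S r)
      ... | _ , inj₁ lost    = ⊥-elim (¬lost lost)
      ... | _ , inj₂ answers = answers _ sl

    invariant⇒OPreventsXWin : OPreventsXWin strategy b₀
    invariant⇒OPreventsXWin =
      (λ r _ _ → proj₁ (respond-correct (proj₂ (reachO-answerable r)))) ,
      (λ r → proj₁ (invariant (reachX-S r))) ,
      (λ r → proj₁ (reachO-answerable r))

Code : Set
Code = Vec Cell 9

index : Node → Fin 9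
index (r , k) = combine r k

index-injective : ∀ {p q} → index p ≡ index q → p ≡ q
index-injective {r , k} {r' , k'} e =
  trans (≡-sym (remQuot-combine r k)) (trans (cong (remQuot 3) e) (remQuot-combine r' k'))

decode : Code → Board
decode c p = Vec.lookup c (index p)

encode : Board → Code
encode b = tabulate (b ∘ remQuot 3)

decode-encode : ∀ b → decode (encode b) ≗ b
decode-encode b (r , k) = trans (lookup∘tabulate (b ∘ remQuot 3) (combine r k)) (cong b (remQuot-combine r k))

encode-decode : ∀ c → encode (decode c) ≡ c
encode-decode c = trans (tabulate-cong λ i → cong (Vec.lookup c) (combine-remQuot {3} 3 i)) (tabulate∘lookup c)

move : Cell → Node → Node → Code → Code
move s p q c = (c [ index p ]≔ empty) [ index q ]≔ s

index-≢ : ∀ {p q} → p ≢ q → index p ≢ index q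
index-≢ p≢q = p≢q ∘ index-injective

decode-move-source : ∀ s {p q} c → p ≢ q → decode (move s p q c) p ≡ empty
decode-move-source s {p} c p≢q =
  trans (lookup∘update′ (index-≢ p≢q) (c [ index p ]≔ empty) s) (lookup∘update (index p) c empty)

decode-move-target : ∀ s p q c → decode (move s p q c) q ≡ s
decode-move-target s p q c = lookup∘update (index q) (c [ index p ]≔ empty) s

decode-move-other : ∀ s {p q} c {u} → u ≢ p → u ≢ q → decode (move s p q c) u ≡ decode c u
decode-move-other s {p} c u≢p u≢q =
  trans (lookup∘update′ (index-≢ u≢q) (c [ index p ]≔ empty) s)
        (lookup∘update′ (index-≢ u≢p) c empty)

Slide-move : ∀ {s c p q} → decode c p ≡ s → decode c q ≡ empty → Adjacent p q →
             Slide s (decode c) (decode (move s p q c))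
Slide-move {s} {c} {p} {q} cp cq adj@(p≢q , _) =
  p , q , adj , cp , cq , decode-move-source s c p≢q , decode-move-target s p q c ,
  λ u → decode-move-other s c

Slide⇒≗move : ∀ {s c b'} (sl : Slide s (decode c) b') → decode (move s (proj₁ sl) (proj₁ (proj₂ sl)) c) ≗ b'
Slide⇒≗move {s} {c} (p , q , (p≢q , _) , _ , _ , b'p , b'q , rest) u with u ≟ⁿ p | u ≟ⁿ q
... | yes refl | _        = trans (decode-move-source s c p≢q) (≡-sym b'p)
... | no _     | yes refl = trans (decode-move-target s p q c) (≡-sym b'q)
... | no u≢p   | no u≢q   = trans (decode-move-other s c u≢p u≢q) (≡-sym (rest u u≢p u≢q))

nodes : List Node
nodes = cartesianProduct (allFin 3) (allFin 3)

∈-nodes : ∀ p → p ∈ nodes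
∈-nodes (r , k) = ∈-cartesianProduct⁺ (∈-allFin r) (∈-allFin k)

holding : Cell → Code → List Node
holding s c = filter (λ p → decode c p ≟ᶜ s) nodes

moves : Cell → Code → List Code
moves s c = map (λ { (p , q) → move s p q c })
                (filter (uncurry adjacent?) (cartesianProduct (holding s c) (holding empty c)))

moves-sound : ∀ {s c c'} → c' ∈ moves s c → Slide s (decode c) (decode c')
moves-sound {s} {c} c'∈ with ∈-map⁻ _ c'∈
... | (p , q) , pq∈ , refl with ∈-filter⁻ (uncurry adjacent?) pq∈
... | pq∈′ , adj with ∈-cartesianProduct⁻ (holding s c) (holding empty c) pq∈′
... | p∈ , q∈ =
  Slide-move {c = c} (proj₂ (∈-filter⁻ (λ p → decode c p ≟ᶜ s) p∈))
                     (proj₂ (∈-filter⁻ (λ q → decode c q ≟ᶜ empty) q∈)) adj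

moves-complete : ∀ {s c b'} → Slide s (decode c) b' → ∃ λ c' → c' ∈ moves s c × decode c' ≗ b'
moves-complete {s} {c} sl@(p , q , adj , cp , cq , _) =
  move s p q c ,
  ∈-map⁺ _ (∈-filter⁺ (uncurry adjacent?) (∈-cartesianProduct⁺ (∈-holding cp) (∈-holding cq)) adj) ,
  Slide⇒≗move {c = c} sl
  where
  ∈-holding : ∀ {s p} → decode c p ≡ s → p ∈ holding s c
  ∈-holding {s} {p} cp = ∈-filter⁺ (λ p → decode c p ≟ᶜ s) (∈-nodes p) cp

module _ {s : Cell} {P : Pred Board 0ℓ} (P-resp : ∀ {b₁ b₂} → b₁ ≗ b₂ → P b₁ → P b₂)
         (P? : ∀ c → Dec (P (decode c))) where

  ∀-Slide? : ∀ c → Dec (∀ b' → Slide s (decode c) b' → P b')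
  ∀-Slide? c = map′
    (λ all b' sl → let c' , c'∈ , c'≗b' = moves-complete sl in P-resp c'≗b' (All.lookup all c'∈))
    (λ all → All.tabulate λ c'∈ → all _ (moves-sound c'∈))
    (all? P? (moves s c))

  ∃-Slide? : ∀ c → Dec (∃ λ b' → Slide s (decode c) b' × P b')
  ∃-Slide? c = map′
    (λ any → let c' , c'∈ , pc' = find any in decode c' , moves-sound c'∈ , pc')
    (λ { (b' , sl , pb') → let c' , c'∈ , c'≗b' = moves-complete sl in
                           Any.map (λ { refl → P-resp (≡-sym ∘ c'≗b') pb' }) c'∈ })
    (any? P? (moves s c))

module _ {S : Pred Board 0ℓ} (S-resp : ∀ {b₁ b₂} → b₁ ≗ b₂ → S b₁ → S b₂)
         (S? : ∀ c → Dec (S (decode c))) where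

  answerable? : ∀ c → Dec (Answerable S (decode c))
  answerable? c = ¬? (wins? xs (decode c)) ×-dec ∃-Slide? S-resp S? c

  defensible? : ∀ c → Dec (Defensible S (decode c))
  defensible? c =
    ¬? (wins? xs (decode c)) ×-dec (wins? os (decode c) ⊎-dec ∀-Slide? Answerable-resp-≗ answerable? c)

  replyInto? : ∀ b → Dec (∃ λ b' → Slide os b b' × S b')
  replyInto? b = map′ (transport (decode-encode b)) (transport (≡-sym ∘ decode-encode b))
                      (∃-Slide? S-resp S? (encode b))
    where
    transport : ∀ {b₁ b₂} → b₁ ≗ b₂ → (∃ λ b' → Slide os b₁ b' × S b') → ∃ λ b' → Slide os b₂ b' × S b'
    transport e (b' , sl , sb') = b' , Slide-resp-≗ e (λ _ → refl) sl , sb'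

data Trie : ℕ → Set where
  leaf : Bool → Trie zero
  node : ∀ {k} → (onEmpty onX onO : Trie k) → Trie (suc k)

lookupᵗ : ∀ {k} → Trie k → Vec Cell k → Bool
lookupᵗ (leaf a)       []          = a
lookupᵗ (node t _ _)   (empty ∷ c) = lookupᵗ t c
lookupᵗ (node _ t _)   (xs ∷ c)    = lookupᵗ t c
lookupᵗ (node _ _ t)   (os ∷ c)    = lookupᵗ t c

tabulateᵗ : ∀ {k} → (Vec Cell k → Bool) → Trie k
tabulateᵗ {zero}  f = leaf (f [])
tabulateᵗ {suc k} f = node (tabulateᵗ (f ∘ (empty ∷_))) (tabulateᵗ (f ∘ (xs ∷_))) (tabulateᵗ (f ∘ (os ∷_)))

Member : Trie 9 → Pred Board 0ℓ
Member t b = T (lookupᵗ t (encode b))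

Member-resp-≗ : ∀ {t b₁ b₂} → b₁ ≗ b₂ → Member t b₁ → Member t b₂
Member-resp-≗ {t} e = subst (T ∘ lookupᵗ t) (tabulate-cong (e ∘ remQuot 3))

member? : ∀ t c → Dec (Member t (decode c))
member? t c = map′ (subst (T ∘ lookupᵗ t) (≡-sym (encode-decode c))) (subst (T ∘ lookupᵗ t) (encode-decode c)) (T? _)

refine : Trie 9 → Trie 9
refine t = tabulateᵗ (λ c → lookupᵗ t c ∧ does (defensible? (Member-resp-≗ {t}) (member? t) c))

-- Starting from the boards with three stones of each colour only shrinks the computation.
approximant : ℕ → Trie 9
approximant zero    = tabulateᵗ (λ c → (Vec.count (_≟ᶜ xs) c ≡ᵇ 3) ∧ (Vec.count (_≟ᶜ os) c ≡ᵇ 3))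
approximant (suc k) = refine (approximant k)

Closed : Trie 9 → Set
Closed t = ∀ c → Member t (decode c) → Defensible (Member t) (decode c)

Closed⇒Defensible : ∀ {t b} → Closed t → Member t b → Defensible (Member t) b
Closed⇒Defensible {t} {b} closed b∈ = Defensible-resp-≗ (decode-encode b)
  (closed (encode b) (Member-resp-≗ {t} (≡-sym ∘ decode-encode b) b∈))

loop : Bool → Bool → Bool → Board
loop tr fr fc p = loop₀ (sym tr fr fc p)

Certified : Trie 9 → Set
Certified t = Closed t × (∀ tr fr fc → Member t (loop tr fr fc))

certified? : ∀ t → Dec (Certified t)
certified? t =
  ∀-Vec? (λ c → member? t c →-dec defensible? (Member-resp-≗ {t}) (member? t) c) ×-dec
  ∀-Bool? λ tr → ∀-Bool? λ fr → ∀-Bool? λ fc → T? (lookupᵗ t (encode (loop tr fr fc)))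

safe : Trie 9
safe = approximant 3

certified-check : does (certified? safe) ≡ true
certified-check = refl

certified : Certified safe
certified = from-does (certified? safe) certified-check

theorem2p5 : (b : Board) → IsLoop b → Σ OStrategy λ σ → OPreventsXWin σ b
theorem2p5 b (tr , fr , fc , b≗loop) =
  strategy , invariant⇒OPreventsXWin (Closed⇒Defensible {safe} (proj₁ certified)) loop-safe
  where
  open InvariantStrategy (replyInto? (Member-resp-≗ {safe}) (member? safe))
  loop-safe : Member safe b
  loop-safe = Member-resp-≗ {safe} (≡-sym ∘ b≗loop) (proj₂ certified tr fr fc)
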